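{- Let $n\ge 2$ be an integer and let $\{I,A_1,\dots,A_m\}$ be a symmetric association scheme on $3n$ points whose strata have dimensions $1,n+1,n-1,n-1$. For each $i$ let $k_i$ be the row sum of $A_i$, let $r_i$ be the eigenvalue of $A_i$ on the stratum of dimension $n+1$, and put $\epsilon_i=(k_i+2r_i)/(n-1)$. Then for every $i$, \[\epsilon_i(n-1)(6n-2\epsilon_in+\epsilon_i)-6r_i(2n-\epsilon_in+\epsilon_i)-(3n+9)r_i^2\ \ge\ 0.\]
   Context: A symmetric association scheme on a set of $N$ points is a set $\{I,A_1,\dots,A_m\}$ of symmetric $N\times N$ $0/1$ matrices summing to the all-ones matrix $J$ whose linear span is closed under multiplication (so $A_iA_j=\sum_k p_{ij}^kA_k$ with constant nonnegative integer coefficients). Such matrices commute and are simultaneously diagonalisable; the strata are the common eigenspaces, i.e. $\mathbb{R}^N$ is the direct sum of the strata and each $A_i$ acts as a scalar on each stratum. One stratum is spanned by the all-ones vector, on which $A_i$ acts as its row sum. (In the paper such a scheme arises by symmetrising a homogeneous coherent configuration, replacing each non-symmetric relation matrix $B$ by $B+B^T$.) -}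

module Defs where

open import Level using (Level; _⊔_) renaming (suc to lsuc)
open import Data.Nat as ℕ using (ℕ)
open import Data.Fin using (Fin; zero; suc)
open import Data.Vec using (Vec; lookup)
import Data.Sum
open import Data.Product using (Σ; ∃; ∃-syntax; _×_; _,_)
open import Relation.Binary.PropositionalEquality using (_≡_)
open import Relation.Binary.Structures using (IsTotalOrder)
open import Relation.Nullary using (¬_)
open import Algebra.Bundles using (CommutativeRing)

sumℕ : ∀ {k} → (Fin k → ℕ) → ℕ
sumℕ {ℕ.zero}  f = 0
sumℕ {ℕ.suc k} f = f zero ℕ.+ sumℕ (λ i → f (suc i))

δ : ∀ {N} → Fin N → Fin N → ℕ
δ zero    zero    = 1
δ zero    (suc y) = 0
δ (suc x) zero    = 0
δ (suc x) (suc y) = δ x y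

module RingOps {c ℓ} (R : CommutativeRing c ℓ) where
  open CommutativeRing R hiding (zero)

  sumR : ∀ {k} → (Fin k → Carrier) → Carrier
  sumR {ℕ.zero}  f = 0#
  sumR {ℕ.suc k} f = f zero + sumR (λ i → f (suc i))

  fromℕ : ℕ → Carrier
  fromℕ ℕ.zero    = 0#
  fromℕ (ℕ.suc n) = 1# + fromℕ n

  pow : Carrier → ℕ → Carrier
  pow x ℕ.zero    = 1#
  pow x (ℕ.suc n) = x * pow x n

  evalPoly : ∀ {k} → Vec Carrier k → Carrier → Carrier
  evalPoly {k} cs x = sumR (λ i → lookup cs i * pow x (Data.Fin.toℕ i))

-- Agda/stdlib has no real numbers; we work
-- over an arbitrary real closed field, which by Tarski transfer satisfies
-- the same first-order statements as ℝ (for each fixed n the statement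
-- below is first-order).

record RealClosedField c ℓ₁ ℓ₂ : Set (lsuc (c ⊔ ℓ₁ ⊔ ℓ₂)) where
  field
    cring : CommutativeRing c ℓ₁
  open CommutativeRing cring public hiding (zero)
  open RingOps cring public
  field
    _≤_          : Carrier → Carrier → Set ℓ₂
    isTotalOrder : IsTotalOrder _≈_ _≤_
    1≉0          : ¬ (1# ≈ 0#)
    inverse      : ∀ x → ¬ (x ≈ 0#) → ∃[ y ] (x * y ≈ 1#)
    +-mono-≤     : ∀ {x y} z → x ≤ y → (x + z) ≤ (y + z)
    *-nonneg     : ∀ {x y} → 0# ≤ x → 0# ≤ y → 0# ≤ (x * y)
    sqrt-exists  : ∀ x → 0# ≤ x → ∃[ y ] (y * y ≈ x)
    odd-root     : ∀ k (cs : Vec Carrier (ℕ.suc (2 ℕ.* k))) →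
                   ∃[ x ] (pow x (ℕ.suc (2 ℕ.* k)) + evalPoly cs x ≈ 0#)

-- Symmetric association schemes {I, A_1, ..., A_m} on N points.
-- Matrices are functions Fin N → Fin N → ℕ; A i is A_{i+1}.

record IsSymAssocScheme (N m : ℕ) (A : Fin m → Fin N → Fin N → ℕ) : Set where
  field
    zero-one   : ∀ i x y → (A i x y ≡ 0) Data.Sum.⊎ (A i x y ≡ 1)
    nonzero    : ∀ i → ∃[ x ] ∃[ y ] (A i x y ≡ 1)
    symmetric  : ∀ i x y → A i x y ≡ A i y x
    sum-J      : ∀ x y → δ x y ℕ.+ sumℕ (λ i → A i x y) ≡ 1
    -- closure of the span under multiplication, with constant
    -- nonnegative integer intersection numbers
    -- (p₀ i j is the coefficient of I, p i j k that of A k)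
    p₀         : Fin m → Fin m → ℕ
    p          : Fin m → Fin m → Fin m → ℕ
    closed     : ∀ i j x y →
                 sumℕ (λ z → A i x z ℕ.* A j z y)
                   ≡ p₀ i j ℕ.* δ x y ℕ.+ sumℕ (λ k → p i j k ℕ.* A k x y)

-- row sum k_i (constant by the scheme axioms; taken at a point x)
rowSum : ∀ {N m} → (Fin m → Fin N → Fin N → ℕ) → Fin m → Fin N → ℕ
rowSum A i x = sumℕ (λ y → A i x y)

-- A decomposition of F^N into s
-- strata, stratum t having dimension d t, is given by a basis B t of
-- each stratum such that all bases together form a basis of F^N, each
-- A_i acts on stratum t as the scalar θ i t, and distinct strata are
-- distinguished by some A_i (so the strata are exactly the common
-- eigenspaces, not a refinement of them).

module _ {c ℓ₁ ℓ₂} (F : RealClosedField c ℓ₁ ℓ₂) where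
  open RealClosedField F

  record Strata (N m s : ℕ) (A : Fin m → Fin N → Fin N → ℕ)
                (d : Fin s → ℕ) : Set (c ⊔ ℓ₁) where
    field
      B : (t : Fin s) → Fin (d t) → Fin N → Carrier
      θ : Fin m → Fin s → Carrier
      eigen    : ∀ i t a x →
                 sumR (λ y → fromℕ (A i x y) * B t a y) ≈ θ i t * B t a x
      spanning : ∀ (v : Fin N → Carrier) →
                 Σ ((t : Fin s) → Fin (d t) → Carrier) λ coef → (∀ x → v x ≈ sumR (λ t → sumR (λ a →
                                        coef t a * B t a x)))
      independent : ∀ (coef : (t : Fin s) → Fin (d t) → Carrier) →
                 (∀ x → sumR (λ t → sumR (λ a → coef t a * B t a x)) ≈ 0#) →
                 ∀ t a → coef t a ≈ 0#
      distinct : ∀ t t' → ¬ (t ≡ t') → ∃[ i ] ¬ (θ i t ≈ θ i t')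

dims : ℕ → Fin 4 → ℕ
dims n zero                   = 1
dims n (suc zero)             = ℕ.suc n
dims n (suc (suc zero))       = n ℕ.∸ 1
dims n (suc (suc (suc zero))) = n ℕ.∸ 1

module Submission where

-- Computing the traces of Aᵢ, Aᵢ² and J = I + ∑ᵢ Aᵢ in a basis adapted to the strata gives
-- ∑ₜ dₜ θᵢₜ = 0, ∑ₜ dₜ θᵢₜ² = 3n kᵢ and ∑ₜ dₜ jₜ = 3n, where θᵢₜ and jₜ are the eigenvalues of Aᵢ
-- and J on stratum t.  From J² = 3n J and Aᵢ J = kᵢ J, each jₜ is 0 or 3n, and θᵢₜ = kᵢ when jₜ ≠ 0;
-- the dimensions then force exactly one stratum with jₜ = 3n, one-dimensional and distinct from the
-- (n + 1)-dimensional one.  Writing r for θᵢ on the latter and s, t for θᵢ on the remaining two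
-- strata, the two moment equations turn the expression of the statement into (n − 1)(s − t)².

open import Defs
open import Data.Nat using (ℕ; _∸_)
open import Data.Fin using (Fin; zero; suc)

open import Algebra.Bundles using (CommutativeRing; RawRing)
open import Algebra.Solver.Ring.AlmostCommutativeRing using (_-Raw-AlmostCommutative⟶_; fromCommutativeRing)
open import Data.Empty using (⊥-elim)
open import Data.Maybe using (Maybe; just; nothing)
import Data.Nat as ℕ
import Data.Nat.Properties as ℕ
open import Data.Product using (Σ-syntax; ∃-syntax; _×_; _,_; proj₁; proj₂)
open import Data.Product.Properties using (≡-dec)
open import Data.Sum using (_⊎_; inj₁; inj₂)
open import Function using (_∘_)
open import Relation.Binary.PropositionalEquality as ≡ using (_≡_)
open import Relation.Nullary using (¬_; yes; no)

sumℕ-cong : ∀ {k} {f g : Fin k → ℕ} → (∀ i → f i ≡ g i) → sumℕ f ≡ sumℕ g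
sumℕ-cong {ℕ.zero}  f≗g = ≡.refl
sumℕ-cong {ℕ.suc k} f≗g = ≡.cong₂ ℕ._+_ (f≗g zero) (sumℕ-cong (f≗g ∘ suc))

sumℕ-zero : ∀ {k} {f : Fin k → ℕ} → (∀ i → f i ≡ 0) → sumℕ f ≡ 0
sumℕ-zero {ℕ.zero}  f≗0 = ≡.refl
sumℕ-zero {ℕ.suc k} f≗0 = ≡.cong₂ ℕ._+_ (f≗0 zero) (sumℕ-zero (f≗0 ∘ suc))

sumℕ≡0⇒≡0 : ∀ {k} (f : Fin k → ℕ) → sumℕ f ≡ 0 → ∀ i → f i ≡ 0
sumℕ≡0⇒≡0 f Σf≡0 zero    = ℕ.m+n≡0⇒m≡0 (f zero) Σf≡0
sumℕ≡0⇒≡0 f Σf≡0 (suc i) = sumℕ≡0⇒≡0 (f ∘ suc) (ℕ.m+n≡0⇒n≡0 (f zero) Σf≡0) i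

δ-refl : ∀ {k} (x : Fin k) → δ x x ≡ 1
δ-refl zero    = ≡.refl
δ-refl (suc x) = δ-refl x

δ-comm : ∀ {k} (x y : Fin k) → δ x y ≡ δ y x
δ-comm zero    zero    = ≡.refl
δ-comm zero    (suc y) = ≡.refl
δ-comm (suc x) zero    = ≡.refl
δ-comm (suc x) (suc y) = δ-comm x y

module SchemeCombinatorics {N m} {A : Fin m → Fin N → Fin N → ℕ}
                           (scheme : IsSymAssocScheme N m A) where
  open IsSymAssocScheme scheme

  diagonal-zero : ∀ i x → A i x x ≡ 0
  diagonal-zero i x = sumℕ≡0⇒≡0 (λ j → A j x x) (ℕ.suc-injective 1+Σ≡1) i
    where
    1+Σ≡1 : 1 ℕ.+ sumℕ (λ j → A j x x) ≡ 1
    1+Σ≡1 = ≡.trans (≡.cong (ℕ._+ _) (≡.sym (δ-refl x))) (sum-J x x)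

  square-diagonal≡p₀ : ∀ i x → sumℕ (λ z → A i x z ℕ.* A i z x) ≡ p₀ i i
  square-diagonal≡p₀ i x = begin
    sumℕ (λ z → A i x z ℕ.* A i z x)                      ≡⟨ closed i i x x ⟩
    p₀ i i ℕ.* δ x x ℕ.+ sumℕ (λ k → p i i k ℕ.* A k x x) ≡⟨ ≡.cong₂ ℕ._+_ (≡.cong (p₀ i i ℕ.*_) (δ-refl x)) Σ≡0 ⟩
    p₀ i i ℕ.* 1 ℕ.+ 0                                    ≡⟨ ℕ.+-identityʳ _ ⟩
    p₀ i i ℕ.* 1                                          ≡⟨ ℕ.*-identityʳ _ ⟩
    p₀ i i                                                ∎
    where
    open ≡.≡-Reasoning
    Σ≡0 : sumℕ (λ k → p i i k ℕ.* A k x x) ≡ 0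
    Σ≡0 = sumℕ-zero (λ k → ≡.trans (≡.cong (p i i k ℕ.*_) (diagonal-zero k x)) (ℕ.*-zeroʳ (p i i k)))

  entry≡entry*transposed : ∀ i x z → A i x z ≡ A i x z ℕ.* A i z x
  entry≡entry*transposed i x z rewrite symmetric i z x with zero-one i x z
  ... | inj₁ Axz≡0 rewrite Axz≡0 = ≡.refl
  ... | inj₂ Axz≡1 rewrite Axz≡1 = ≡.refl

  rowSum≡p₀ : ∀ i x → rowSum A i x ≡ p₀ i i
  rowSum≡p₀ i x = ≡.trans (sumℕ-cong (entry≡entry*transposed i x)) (square-diagonal≡p₀ i x)

χ : ∀ {a b} {P : Set a} {Q : Set b} → P ⊎ Q → ℕ
χ (inj₁ _) = 0
χ (inj₂ _) = 1

data DimensionOne (q : ℕ) : Fin 4 → Set where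
  stratum₀ : DimensionOne q zero
  stratum₂ : q ≡ 0 → DimensionOne q (suc (suc zero))
  stratum₃ : q ≡ 0 → DimensionOne q (suc (suc (suc zero)))

locate-dimension-one : ∀ q {ℓ} {P Q : Fin 4 → Set ℓ} (o : ∀ t → P t ⊎ Q t) →
                       sumℕ (λ t → χ (o t) ℕ.* dims (2 ℕ.+ q) t) ≡ 1 →
                       ∃[ t ] (DimensionOne q t × Q t)
locate-dimension-one q o Σ≡1
  with o zero | o (suc zero) | o (suc (suc zero)) | o (suc (suc (suc zero)))
... | inj₂ Q₀ | inj₁ _ | inj₁ _  | inj₁ _  = zero , stratum₀ , Q₀
... | inj₁ _  | inj₁ _ | inj₂ Q₂ | inj₁ _  =
  suc (suc zero) , stratum₂ (ℕ.m+n≡0⇒m≡0 q (ℕ.m+n≡0⇒m≡0 (q ℕ.+ 0) (ℕ.suc-injective Σ≡1))) , Q₂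
... | inj₁ _  | inj₁ _ | inj₁ _  | inj₂ Q₃ =
  suc (suc (suc zero)) , stratum₃ (ℕ.m+n≡0⇒m≡0 q (ℕ.m+n≡0⇒m≡0 (q ℕ.+ 0) (ℕ.suc-injective Σ≡1))) , Q₃
... | inj₁ _  | inj₁ _ | inj₂ _  | inj₂ _
  with () ← ℕ.m+n≡0⇒n≡0 (q ℕ.+ 0) (ℕ.suc-injective Σ≡1)
... | inj₁ _  | inj₁ _ | inj₁ _  | inj₁ _  with () ← Σ≡1
... | inj₁ _  | inj₂ _ | _       | _       with () ← Σ≡1
... | inj₂ _  | inj₂ _ | _       | _       with () ← Σ≡1
... | inj₂ _  | inj₁ _ | inj₂ _  | _       with () ← Σ≡1
... | inj₂ _  | inj₁ _ | inj₁ _  | inj₂ _  with () ← Σ≡1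

module NaturalEmbedding {c ℓ} (R : CommutativeRing c ℓ) where
  open CommutativeRing R hiding (zero)
  open RingOps R using (fromℕ)
  open import Relation.Binary.Reasoning.Setoid setoid

  fromℕ-homo-+ : ∀ m n → fromℕ (m ℕ.+ n) ≈ fromℕ m + fromℕ n
  fromℕ-homo-+ ℕ.zero    n = sym (+-identityˡ _)
  fromℕ-homo-+ (ℕ.suc m) n = trans (+-congˡ (fromℕ-homo-+ m n)) (sym (+-assoc _ _ _))

  fromℕ-homo-* : ∀ m n → fromℕ (m ℕ.* n) ≈ fromℕ m * fromℕ n
  fromℕ-homo-* ℕ.zero    n = sym (zeroˡ _)
  fromℕ-homo-* (ℕ.suc m) n = begin
    fromℕ (n ℕ.+ m ℕ.* n)            ≈⟨ fromℕ-homo-+ n (m ℕ.* n) ⟩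
    fromℕ n + fromℕ (m ℕ.* n)        ≈⟨ +-cong (sym (*-identityˡ _)) (fromℕ-homo-* m n) ⟩
    1# * fromℕ n + fromℕ m * fromℕ n ≈⟨ distribʳ _ _ _ ⟨
    (1# + fromℕ m) * fromℕ n         ∎

module DifferenceCoefficients {c ℓ} (R : CommutativeRing c ℓ) where
  open CommutativeRing R hiding (zero)
  open RingOps R using (fromℕ)
  open NaturalEmbedding R
  open import Algebra.Properties.Ring ring
    using (-‿+-comm; -0#≈0#; ⁻¹-anti-homo‿-; [y-z]x≈yx-zx; x[y-z]≈xy-xz)
  open import Algebra.Properties.CommutativeSemigroup +-commutativeSemigroup using (interchange)
  open import Relation.Binary.Reasoning.Setoid setoid

  reduce : ℕ × ℕ → ℕ × ℕ
  reduce (ℕ.suc p , ℕ.suc q) = reduce (p , q)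
  reduce d                   = d

  Difference : RawRing _ _
  Difference = record
    { Carrier = ℕ × ℕ
    ; _≈_     = _≡_
    ; _+_     = λ { (p , q) (p′ , q′) → reduce (p ℕ.+ p′ , q ℕ.+ q′) }
    ; _*_     = λ { (p , q) (p′ , q′) → reduce (p ℕ.* p′ ℕ.+ q ℕ.* q′ , p ℕ.* q′ ℕ.+ q ℕ.* p′) }
    ; -_      = λ { (p , q) → (q , p) }
    ; 0#      = (0 , 0)
    ; 1#      = (1 , 0)
    }

  -- (p , q) stands for p − q.  The operations keep pairs reduced, so that equal polynomials get
  -- identical normal forms (the solver compares them by refl); (0 , 0) and (1 , 0) denote 0# and 1#
  -- themselves.
  ⟦_⟧ : ℕ × ℕ → Carrier
  ⟦ ℕ.suc p , ℕ.suc q ⟧ = ⟦ p , q ⟧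
  ⟦ 0 , ℕ.suc q ⟧       = - fromℕ (ℕ.suc q)
  ⟦ 1 , 0 ⟧             = 1#
  ⟦ p , 0 ⟧             = fromℕ p

  ⟦reduce⟧ : ∀ d → ⟦ reduce d ⟧ ≡ ⟦ d ⟧
  ⟦reduce⟧ (ℕ.suc p , ℕ.suc q) = ⟦reduce⟧ (p , q)
  ⟦reduce⟧ (ℕ.zero , q)        = ≡.refl
  ⟦reduce⟧ (ℕ.suc p , ℕ.zero)  = ≡.refl

  [x+y]-[u+v]≈[x-u]+[y-v] : ∀ x y u v → (x + y) - (u + v) ≈ (x - u) + (y - v)
  [x+y]-[u+v]≈[x-u]+[y-v] x y u v = begin
    (x + y) - (u + v)    ≈⟨ +-congˡ (-‿+-comm u v) ⟨
    (x + y) + (- u - v)  ≈⟨ interchange x y (- u) (- v) ⟩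
    (x - u) + (y - v)    ∎

  x-0≈x : ∀ x → x - 0# ≈ x
  x-0≈x x = trans (+-congˡ -0#≈0#) (+-identityʳ x)

  ⟦⟧≈difference : ∀ p q → ⟦ p , q ⟧ ≈ fromℕ p - fromℕ q
  ⟦⟧≈difference ℕ.zero ℕ.zero                   = sym (-‿inverseʳ 0#)
  ⟦⟧≈difference ℕ.zero (ℕ.suc q)                = sym (+-identityˡ _)
  ⟦⟧≈difference (ℕ.suc ℕ.zero) ℕ.zero          = sym (trans (x-0≈x _) (+-identityʳ 1#))
  ⟦⟧≈difference (ℕ.suc (ℕ.suc p)) ℕ.zero       = sym (x-0≈x _)
  ⟦⟧≈difference (ℕ.suc p) (ℕ.suc q) = begin
    ⟦ p , q ⟧                        ≈⟨ ⟦⟧≈difference p q ⟩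
    fromℕ p - fromℕ q                ≈⟨ +-identityˡ _ ⟨
    0# + (fromℕ p - fromℕ q)         ≈⟨ +-congʳ (-‿inverseʳ 1#) ⟨
    (1# - 1#) + (fromℕ p - fromℕ q)  ≈⟨ [x+y]-[u+v]≈[x-u]+[y-v] 1# _ 1# _ ⟨
    (1# + fromℕ p) - (1# + fromℕ q)  ∎

  ⟦⟧-homo-+ : ∀ p q p′ q′ → ⟦ p ℕ.+ p′ , q ℕ.+ q′ ⟧ ≈ ⟦ p , q ⟧ + ⟦ p′ , q′ ⟧
  ⟦⟧-homo-+ p q p′ q′ = begin
    ⟦ p ℕ.+ p′ , q ℕ.+ q′ ⟧                      ≈⟨ ⟦⟧≈difference (p ℕ.+ p′) (q ℕ.+ q′) ⟩
    fromℕ (p ℕ.+ p′) - fromℕ (q ℕ.+ q′)          ≈⟨ +-cong (fromℕ-homo-+ p p′) (-‿cong (fromℕ-homo-+ q q′)) ⟩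
    (fromℕ p + fromℕ p′) - (fromℕ q + fromℕ q′)  ≈⟨ [x+y]-[u+v]≈[x-u]+[y-v] _ _ _ _ ⟩
    (fromℕ p - fromℕ q) + (fromℕ p′ - fromℕ q′)  ≈⟨ +-cong (⟦⟧≈difference p q) (⟦⟧≈difference p′ q′) ⟨
    ⟦ p , q ⟧ + ⟦ p′ , q′ ⟧                      ∎

  ⟦⟧-homo-* : ∀ p q p′ q′ →
              ⟦ p ℕ.* p′ ℕ.+ q ℕ.* q′ , p ℕ.* q′ ℕ.+ q ℕ.* p′ ⟧ ≈ ⟦ p , q ⟧ * ⟦ p′ , q′ ⟧
  ⟦⟧-homo-* p q p′ q′ = begin
    ⟦ p ℕ.* p′ ℕ.+ q ℕ.* q′ , p ℕ.* q′ ℕ.+ q ℕ.* p′ ⟧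
      ≈⟨ ⟦⟧≈difference (p ℕ.* p′ ℕ.+ q ℕ.* q′) (p ℕ.* q′ ℕ.+ q ℕ.* p′) ⟩
    fromℕ (p ℕ.* p′ ℕ.+ q ℕ.* q′) - fromℕ (p ℕ.* q′ ℕ.+ q ℕ.* p′)
      ≈⟨ +-cong (fromℕ-homo-+ (p ℕ.* p′) _) (-‿cong (fromℕ-homo-+ (p ℕ.* q′) _)) ⟩
    (fromℕ (p ℕ.* p′) + fromℕ (q ℕ.* q′)) - (fromℕ (p ℕ.* q′) + fromℕ (q ℕ.* p′))
      ≈⟨ +-cong (+-cong (fromℕ-homo-* p p′) (fromℕ-homo-* q q′))
                (-‿cong (+-cong (fromℕ-homo-* p q′) (fromℕ-homo-* q p′))) ⟩
    (P * P′ + Q * Q′) - (P * Q′ + Q * P′)  ≈⟨ [x+y]-[u+v]≈[x-u]+[y-v] _ _ _ _ ⟩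
    (P * P′ - P * Q′) + (Q * Q′ - Q * P′)  ≈⟨ +-congˡ (⁻¹-anti-homo‿- _ _) ⟨
    (P * P′ - P * Q′) - (Q * P′ - Q * Q′)  ≈⟨ +-cong (x[y-z]≈xy-xz P P′ Q′) (-‿cong (x[y-z]≈xy-xz Q P′ Q′)) ⟨
    P * (P′ - Q′) - Q * (P′ - Q′)          ≈⟨ [y-z]x≈yx-zx _ P Q ⟨
    (P - Q) * (P′ - Q′)                    ≈⟨ *-cong (⟦⟧≈difference p q) (⟦⟧≈difference p′ q′) ⟨
    ⟦ p , q ⟧ * ⟦ p′ , q′ ⟧                ∎
    where
    P Q P′ Q′ : Carrier
    P = fromℕ p ; Q = fromℕ q ; P′ = fromℕ p′ ; Q′ = fromℕ q′

  morphism : Difference -Raw-AlmostCommutative⟶ fromCommutativeRing R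
  morphism = record
    { ⟦_⟧    = ⟦_⟧
    ; +-homo = λ { (p , q) (p′ , q′) → trans (reflexive (⟦reduce⟧ (p ℕ.+ p′ , q ℕ.+ q′))) (⟦⟧-homo-+ p q p′ q′) }
    ; *-homo = λ { (p , q) (p′ , q′) → trans (reflexive (⟦reduce⟧ (p ℕ.* p′ ℕ.+ q ℕ.* q′ , p ℕ.* q′ ℕ.+ q ℕ.* p′))) (⟦⟧-homo-* p q p′ q′) }
    ; -‿homo = λ { (p , q) → begin
        ⟦ q , p ⟧              ≈⟨ ⟦⟧≈difference q p ⟩
        fromℕ q - fromℕ p      ≈⟨ ⁻¹-anti-homo‿- _ _ ⟨
        - (fromℕ p - fromℕ q)  ≈⟨ -‿cong (⟦⟧≈difference p q) ⟨
        - ⟦ p , q ⟧            ∎ }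
    ; 0-homo = refl
    ; 1-homo = refl
    }

  _≟_ : ∀ d d′ → Maybe (⟦ d ⟧ ≈ ⟦ d′ ⟧)
  d ≟ d′ with ≡-dec ℕ._≟_ ℕ._≟_ d d′
  ... | yes d≡d′ = just (reflexive (≡.cong ⟦_⟧ d≡d′))
  ... | no _   = nothing

module RingSolver {c ℓ} (R : CommutativeRing c ℓ) where
  open DifferenceCoefficients R using (Difference; morphism; _≟_)
  open import Algebra.Solver.Ring Difference (fromCommutativeRing R) morphism _≟_ public

  -- ‵ k denotes fromℕ k and ı denotes 1#, verbatim, as solved goals must match them exactly.
  ‵ : ∀ {n} → ℕ → Polynomial n
  ‵ ℕ.zero    = con (0 , 0)
  ‵ (ℕ.suc k) = con (1 , 0) :+ ‵ k

  ı : ∀ {n} → Polynomial n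
  ı = con (1 , 0)

module LinearAlgebra {c ℓ} (R : CommutativeRing c ℓ) where
  open CommutativeRing R hiding (zero)
  open RingOps R using (sumR; fromℕ)
  open NaturalEmbedding R
  open import Algebra.Properties.Semiring.Sum semiring
    using (sum; sum-cong-≋; sum-cong-≗; ∑-comm; ∑-distrib-+; *-distribˡ-sum; *-distribʳ-sum; sum-replicate-zero)
    public
  open import Algebra.Properties.Ring ring using (-1*x≈-x; [y-z]x≈yx-zx; x∙y⁻¹≈ε⇒x≈y; x≈y⇒x∙y⁻¹≈ε)
  open import Algebra.Properties.CommutativeSemigroup *-commutativeSemigroup using (x∙yz≈y∙xz)
  open import Relation.Binary.Reasoning.Setoid setoid

  sumR≡sum : ∀ {k} (f : Fin k → Carrier) → sumR f ≡ sum f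
  sumR≡sum {ℕ.zero}  f = ≡.refl
  sumR≡sum {ℕ.suc k} f = ≡.cong (f zero +_) (sumR≡sum (f ∘ suc))

  fromℕ-sumℕ : ∀ {k} (f : Fin k → ℕ) → fromℕ (sumℕ f) ≈ sum (fromℕ ∘ f)
  fromℕ-sumℕ {ℕ.zero}  f = refl
  fromℕ-sumℕ {ℕ.suc k} f = trans (fromℕ-homo-+ (f zero) _) (+-congˡ (fromℕ-sumℕ (f ∘ suc)))

  ∑-const : ∀ k x → sum {k} (λ _ → x) ≈ fromℕ k * x
  ∑-const ℕ.zero    x = sym (zeroˡ x)
  ∑-const (ℕ.suc k) x = trans (+-cong (sym (*-identityˡ x)) (∑-const k x)) (sym (distribʳ x 1# _))

  ∑-neg : ∀ {k} (f : Fin k → Carrier) → sum (λ i → - f i) ≈ - sum f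
  ∑-neg f = begin
    sum (λ i → - f i)       ≈⟨ sum-cong-≋ (λ i → -1*x≈-x (f i)) ⟨
    sum (λ i → - 1# * f i)  ≈⟨ *-distribˡ-sum (- 1#) f ⟨
    - 1# * sum f            ≈⟨ -1*x≈-x (sum f) ⟩
    - sum f                 ∎

  ∑-distrib-- : ∀ {k} (f g : Fin k → Carrier) → sum (λ i → f i - g i) ≈ sum f - sum g
  ∑-distrib-- f g = trans (∑-distrib-+ f (λ i → - g i)) (+-congˡ (∑-neg g))

  ∑-zero : ∀ {k} {f : Fin k → Carrier} → (∀ i → f i ≈ 0#) → sum f ≈ 0#
  ∑-zero {k} f≈0 = trans (sum-cong-≋ f≈0) (sum-replicate-zero k)

  ∑-δ : ∀ {k} (x : Fin k) (f : Fin k → Carrier) → sum (λ y → fromℕ (δ x y) * f y) ≈ f x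
  ∑-δ zero    f = trans (+-cong (trans (*-congʳ (+-identityʳ 1#)) (*-identityˡ (f zero)))
                                (∑-zero (λ y → zeroˡ (f (suc y)))))
                        (+-identityʳ (f zero))
  ∑-δ (suc x) f = trans (+-cong (zeroˡ (f zero)) (∑-δ x (f ∘ suc))) (+-identityˡ _)

  Matrix : ℕ → Set c
  Matrix N = Fin N → Fin N → Carrier

  _·_ : ∀ {N} → Matrix N → Matrix N → Matrix N
  (M · M′) x y = sum (λ z → M x z * M′ z y)

  trace : ∀ {N} → Matrix N → Carrier
  trace M = sum (λ x → M x x)

  J : ∀ {N} → Matrix N
  J _ _ = 1#

  Eigenvector : ∀ {N} → Matrix N → Carrier → (Fin N → Carrier) → Set ℓ
  Eigenvector M μ v = ∀ x → sum (λ y → M x y * v y) ≈ μ * v x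

  eigenvector-· : ∀ {N} {M M′ : Matrix N} {μ μ′ v} →
                  Eigenvector M μ v → Eigenvector M′ μ′ v → Eigenvector (M · M′) (μ * μ′) v
  eigenvector-· {M = M} {M′} {μ} {μ′} {v} Mv Mv′ x = begin
    sum (λ y → sum (λ z → M x z * M′ z y) * v y)
      ≈⟨ sum-cong-≋ (λ y → trans (*-distribʳ-sum (v y) (λ z → M x z * M′ z y))
                                 (sum-cong-≋ (λ z → *-assoc (M x z) (M′ z y) (v y)))) ⟩
    sum (λ y → sum (λ z → M x z * (M′ z y * v y)))  ≈⟨ ∑-comm (λ y z → M x z * (M′ z y * v y)) ⟩
    sum (λ z → sum (λ y → M x z * (M′ z y * v y)))  ≈⟨ sum-cong-≋ (λ z → *-distribˡ-sum (M x z) (λ y → M′ z y * v y)) ⟨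
    sum (λ z → M x z * sum (λ y → M′ z y * v y))    ≈⟨ sum-cong-≋ (λ z → trans (*-congˡ (Mv′ z)) (x∙yz≈y∙xz (M x z) μ′ (v z))) ⟩
    sum (λ z → μ′ * (M x z * v z))                  ≈⟨ *-distribˡ-sum μ′ (λ z → M x z * v z) ⟨
    μ′ * sum (λ z → M x z * v z)                    ≈⟨ *-congˡ (Mv x) ⟩
    μ′ * (μ * v x)                                  ≈⟨ x∙yz≈y∙xz μ′ μ (v x) ⟩
    μ * (μ′ * v x)                                  ≈⟨ *-assoc μ μ′ (v x) ⟨
    (μ * μ′) * v x                                  ∎

  J-eigenvector-constant : ∀ {N ν v} → Eigenvector {N} J ν v → ∀ x → sum v ≈ ν * v x
  J-eigenvector-constant {v = v} Jv x = trans (sum-cong-≋ (λ y → sym (*-identityˡ (v y)))) (Jv x)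

  J-eigenvalue : ∀ {N ν v} → Eigenvector {N} J ν v → ∀ x → (ν * (fromℕ N - ν)) * v x ≈ 0#
  J-eigenvalue {N} {ν} {v} Jv x = begin
    (ν * (fromℕ N - ν)) * v x        ≈⟨ trans (*-congʳ (*-comm _ _)) (*-assoc _ _ _) ⟩
    (fromℕ N - ν) * (ν * v x)        ≈⟨ *-congˡ (J-eigenvector-constant Jv x) ⟨
    (fromℕ N - ν) * sum v            ≈⟨ [y-z]x≈yx-zx (sum v) (fromℕ N) ν ⟩
    fromℕ N * sum v - ν * sum v      ≈⟨ x≈y⇒x∙y⁻¹≈ε Nσ≈νσ ⟩
    0#                               ∎
    where
    Nσ≈νσ : fromℕ N * sum v ≈ ν * sum v
    Nσ≈νσ = begin
      fromℕ N * sum v            ≈⟨ ∑-const N (sum v) ⟨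
      sum {N} (λ _ → sum v)      ≈⟨ sum-cong-≋ (J-eigenvector-constant Jv) ⟩
      sum (λ x → ν * v x)        ≈⟨ *-distribˡ-sum ν v ⟨
      ν * sum v                  ∎

  constant-row-sums : ∀ {N} {M : Matrix N} {κ μ ν v} → (∀ x → sum (M x) ≈ κ) →
                      Eigenvector M μ v → Eigenvector J ν v → ∀ x → (μ * ν) * v x ≈ (κ * ν) * v x
  constant-row-sums {M = M} {κ} {μ} {ν} {v} rows Mv Jv x = begin
    (μ * ν) * v x                  ≈⟨ trans (*-congʳ (*-comm μ ν)) (*-assoc ν μ (v x)) ⟩
    ν * (μ * v x)                  ≈⟨ *-congˡ (Mv x) ⟨
    ν * sum (λ y → M x y * v y)    ≈⟨ *-distribˡ-sum ν (λ y → M x y * v y) ⟩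
    sum (λ y → ν * (M x y * v y))  ≈⟨ sum-cong-≋ (λ y → trans (x∙yz≈y∙xz ν (M x y) (v y)) (*-congˡ (sym (J-eigenvector-constant Jv y)))) ⟩
    sum (λ y → M x y * sum v)      ≈⟨ *-distribʳ-sum (sum v) (M x) ⟨
    sum (M x) * sum v              ≈⟨ *-cong (rows x) (J-eigenvector-constant Jv x) ⟩
    κ * (ν * v x)                  ≈⟨ *-assoc κ ν (v x) ⟨
    (κ * ν) * v x                  ∎

  Coordinates : (s : ℕ) → (Fin s → ℕ) → Set c
  Coordinates s d = (t : Fin s) → Fin (d t) → Carrier

  ∑ᵇ : ∀ {s} {d : Fin s → ℕ} → Coordinates s d → Carrier
  ∑ᵇ f = sum (λ t → sum (f t))

  sumR²≡∑ᵇ : ∀ {s} {d : Fin s → ℕ} (f : Coordinates s d) → sumR (λ t → sumR (f t)) ≡ ∑ᵇ f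
  sumR²≡∑ᵇ f = ≡.trans (sumR≡sum (λ t → sumR (f t))) (sum-cong-≗ (λ t → sumR≡sum (f t)))

  ∑ᵇ-cong : ∀ {s} {d : Fin s → ℕ} {f g : Coordinates s d} → (∀ t a → f t a ≈ g t a) → ∑ᵇ f ≈ ∑ᵇ g
  ∑ᵇ-cong f≈g = sum-cong-≋ (λ t → sum-cong-≋ (f≈g t))

  *-distribˡ-∑ᵇ : ∀ {s} {d : Fin s → ℕ} x (f : Coordinates s d) → x * ∑ᵇ f ≈ ∑ᵇ (λ t a → x * f t a)
  *-distribˡ-∑ᵇ x f = trans (*-distribˡ-sum x (λ t → sum (f t))) (sum-cong-≋ (λ t → *-distribˡ-sum x (f t)))

  ∑-∑ᵇ-comm : ∀ {N s} {d : Fin s → ℕ} (f : Fin N → Coordinates s d) →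
              sum (λ y → ∑ᵇ (f y)) ≈ ∑ᵇ (λ t a → sum (λ y → f y t a))
  ∑-∑ᵇ-comm f = trans (∑-comm (λ y t → sum (f y t))) (sum-cong-≋ (λ t → ∑-comm (λ y a → f y t a)))

  ∑ᵇ-distrib-- : ∀ {s} {d : Fin s → ℕ} (f g : Coordinates s d) →
                 ∑ᵇ (λ t a → f t a - g t a) ≈ ∑ᵇ f - ∑ᵇ g
  ∑ᵇ-distrib-- f g = trans (sum-cong-≋ (λ t → ∑-distrib-- (f t) (g t)))
                           (∑-distrib-- (λ t → sum (f t)) (λ t → sum (g t)))

  ∑ᵇ-const : ∀ {s} {d : Fin s → ℕ} (μ : Fin s → Carrier) →
             ∑ᵇ {d = d} (λ t _ → μ t) ≈ sum (λ t → fromℕ (d t) * μ t)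
  ∑ᵇ-const {d = d} μ = sum-cong-≋ (λ t → ∑-const (d t) (μ t))

  δᵇ : ∀ {s} {d : Fin s → ℕ} (t : Fin s) → Fin (d t) → Coordinates s d
  δᵇ zero    a zero    a′ = fromℕ (δ a a′)
  δᵇ zero    _ (suc _) _  = 0#
  δᵇ (suc _) _ zero    _  = 0#
  δᵇ {d = d} (suc t) a (suc t′) a′ = δᵇ {d = d ∘ suc} t a t′ a′

  δᵇ-refl : ∀ {s} {d : Fin s → ℕ} (t : Fin s) (a : Fin (d t)) → δᵇ {d = d} t a t a ≈ 1#
  δᵇ-refl zero            a = trans (reflexive (≡.cong fromℕ (δ-refl a))) (+-identityʳ 1#)
  δᵇ-refl {d = d} (suc t) a = δᵇ-refl {d = d ∘ suc} t a

  ∑ᵇ-δᵇ : ∀ {s} {d : Fin s → ℕ} (t : Fin s) (a : Fin (d t)) (w : Coordinates s d) →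
          ∑ᵇ (λ t′ a′ → δᵇ {d = d} t a t′ a′ * w t′ a′) ≈ w t a
  ∑ᵇ-δᵇ zero a w =
    trans (+-cong (∑-δ a (w zero)) (∑-zero (λ t′ → ∑-zero (λ a′ → zeroˡ (w (suc t′) a′)))))
          (+-identityʳ _)
  ∑ᵇ-δᵇ {d = d} (suc t) a w =
    trans (+-cong (∑-zero (λ a′ → zeroˡ (w zero a′))) (∑ᵇ-δᵇ {d = d ∘ suc} t a (w ∘ suc)))
          (+-identityˡ _)

  module Basis {N s} {d : Fin s → ℕ} (B : (t : Fin s) → Fin (d t) → Fin N → Carrier)
    (spanning : ∀ (v : Fin N → Carrier) →
                Σ[ κ ∈ Coordinates s d ] (∀ x → v x ≈ ∑ᵇ (λ t a → κ t a * B t a x)))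
    (independent : ∀ (κ : Coordinates s d) →
                   (∀ x → ∑ᵇ (λ t a → κ t a * B t a x) ≈ 0#) → ∀ t a → κ t a ≈ 0#)
    where

    coordinates-unique : ∀ (κ κ′ : Coordinates s d) →
                         (∀ x → ∑ᵇ (λ t a → κ t a * B t a x) ≈ ∑ᵇ (λ t a → κ′ t a * B t a x)) →
                         ∀ t a → κ t a ≈ κ′ t a
    coordinates-unique κ κ′ same t a =
      x∙y⁻¹≈ε⇒x≈y _ _ (independent (λ t a → κ t a - κ′ t a) difference-vanishes t a)
      where
      difference-vanishes : ∀ x → ∑ᵇ (λ t a → (κ t a - κ′ t a) * B t a x) ≈ 0#
      difference-vanishes x = begin
        ∑ᵇ (λ t a → (κ t a - κ′ t a) * B t a x)
          ≈⟨ ∑ᵇ-cong (λ t a → [y-z]x≈yx-zx (B t a x) (κ t a) (κ′ t a)) ⟩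
        ∑ᵇ (λ t a → κ t a * B t a x - κ′ t a * B t a x)
          ≈⟨ ∑ᵇ-distrib-- (λ t a → κ t a * B t a x) (λ t a → κ′ t a * B t a x) ⟩
        ∑ᵇ (λ t a → κ t a * B t a x) - ∑ᵇ (λ t a → κ′ t a * B t a x)
          ≈⟨ x≈y⇒x∙y⁻¹≈ε (same x) ⟩
        0# ∎

    unitCoordinates : Fin N → Coordinates s d
    unitCoordinates x = proj₁ (spanning (λ y → fromℕ (δ x y)))

    unit-expansion : ∀ x y → fromℕ (δ x y) ≈ ∑ᵇ (λ t a → unitCoordinates x t a * B t a y)
    unit-expansion x = proj₂ (spanning (λ y → fromℕ (δ x y)))

    dual-pairing : ∀ t a → sum (λ x → unitCoordinates x t a * B t a x) ≈ 1#
    dual-pairing t a = begin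
      sum (λ x → unitCoordinates x t a * B t a x)  ≈⟨ sum-cong-≋ (λ x → *-comm (unitCoordinates x t a) (B t a x)) ⟩
      C t a                                        ≈⟨ coordinates-unique C (δᵇ t a) expansions t a ⟩
      δᵇ {d = d} t a t a                           ≈⟨ δᵇ-refl t a ⟩
      1#                                           ∎
      where
      C : Coordinates s d
      C t′ a′ = sum (λ x → B t a x * unitCoordinates x t′ a′)

      expansions : ∀ y → ∑ᵇ (λ t′ a′ → C t′ a′ * B t′ a′ y) ≈ ∑ᵇ (λ t′ a′ → δᵇ t a t′ a′ * B t′ a′ y)
      expansions y = begin
        ∑ᵇ (λ t′ a′ → C t′ a′ * B t′ a′ y)
          ≈⟨ ∑ᵇ-cong (λ t′ a′ → trans (*-distribʳ-sum (B t′ a′ y) (λ x → B t a x * unitCoordinates x t′ a′))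
                                      (sum-cong-≋ (λ x → *-assoc (B t a x) (unitCoordinates x t′ a′) (B t′ a′ y)))) ⟩
        ∑ᵇ (λ t′ a′ → sum (λ x → B t a x * (unitCoordinates x t′ a′ * B t′ a′ y)))
          ≈⟨ ∑-∑ᵇ-comm (λ x t′ a′ → B t a x * (unitCoordinates x t′ a′ * B t′ a′ y)) ⟨
        sum (λ x → ∑ᵇ (λ t′ a′ → B t a x * (unitCoordinates x t′ a′ * B t′ a′ y)))
          ≈⟨ sum-cong-≋ (λ x → *-distribˡ-∑ᵇ (B t a x) (λ t′ a′ → unitCoordinates x t′ a′ * B t′ a′ y)) ⟨
        sum (λ x → B t a x * ∑ᵇ (λ t′ a′ → unitCoordinates x t′ a′ * B t′ a′ y))
          ≈⟨ sum-cong-≋ (λ x → *-congˡ (unit-expansion x y)) ⟨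
        sum (λ x → B t a x * fromℕ (δ x y))
          ≈⟨ sum-cong-≋ (λ x → trans (*-comm (B t a x) _) (*-congʳ (reflexive (≡.cong fromℕ (δ-comm x y))))) ⟩
        sum (λ x → fromℕ (δ y x) * B t a x)
          ≈⟨ ∑-δ y (B t a) ⟩
        B t a y
          ≈⟨ ∑ᵇ-δᵇ t a (λ t′ a′ → B t′ a′ y) ⟨
        ∑ᵇ (λ t′ a′ → δᵇ t a t′ a′ * B t′ a′ y) ∎

    basis-vector-nonzero : ∀ {t a} κ → (∀ x → κ * B t a x ≈ 0#) → κ ≈ 0#
    basis-vector-nonzero {t} {a} κ κB≈0 = begin
      κ                                                  ≈⟨ *-identityʳ κ ⟨
      κ * 1#                                             ≈⟨ *-congˡ (dual-pairing t a) ⟨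
      κ * sum (λ x → unitCoordinates x t a * B t a x)    ≈⟨ *-distribˡ-sum κ (λ x → unitCoordinates x t a * B t a x) ⟩
      sum (λ x → κ * (unitCoordinates x t a * B t a x))  ≈⟨ ∑-zero (λ x → trans (x∙yz≈y∙xz κ _ _) (trans (*-congˡ (κB≈0 x)) (zeroʳ _))) ⟩
      0#                                                 ∎

    scalars-unique : ∀ {t a} κ κ′ → (∀ x → κ * B t a x ≈ κ′ * B t a x) → κ ≈ κ′
    scalars-unique {t} {a} κ κ′ same =
      x∙y⁻¹≈ε⇒x≈y κ κ′ (basis-vector-nonzero (κ - κ′) (λ x →
        trans ([y-z]x≈yx-zx (B t a x) κ κ′) (x≈y⇒x∙y⁻¹≈ε (same x))))

    trace-eigenbasis : ∀ {M : Matrix N} {μ : Fin s → Carrier} → (∀ t a → Eigenvector M (μ t) (B t a)) →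
                       trace M ≈ sum (λ t → fromℕ (d t) * μ t)
    trace-eigenbasis {M} {μ} eigen = begin
      sum (λ x → M x x)
        ≈⟨ sum-cong-≋ (λ x → ∑-δ x (M x)) ⟨
      sum (λ x → sum (λ y → fromℕ (δ x y) * M x y))
        ≈⟨ sum-cong-≋ (λ x → sum-cong-≋ (λ y → trans (*-comm _ (M x y)) (*-congˡ (unit-expansion x y)))) ⟩
      sum (λ x → sum (λ y → M x y * ∑ᵇ (λ t a → u x t a * B t a y)))
        ≈⟨ sum-cong-≋ (λ x → sum-cong-≋ (λ y → trans (*-distribˡ-∑ᵇ (M x y) (λ t a → u x t a * B t a y))
                                                    (∑ᵇ-cong (λ t a → x∙yz≈y∙xz (M x y) (u x t a) (B t a y))))) ⟩
      sum (λ x → sum (λ y → ∑ᵇ (λ t a → u x t a * (M x y * B t a y))))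
        ≈⟨ sum-cong-≋ (λ x → ∑-∑ᵇ-comm (λ y t a → u x t a * (M x y * B t a y))) ⟩
      sum (λ x → ∑ᵇ (λ t a → sum (λ y → u x t a * (M x y * B t a y))))
        ≈⟨ sum-cong-≋ (λ x → ∑ᵇ-cong (λ t a → trans (sym (*-distribˡ-sum (u x t a) (λ y → M x y * B t a y))) (*-congˡ (eigen t a x)))) ⟩
      sum (λ x → ∑ᵇ (λ t a → u x t a * (μ t * B t a x)))
        ≈⟨ ∑-∑ᵇ-comm (λ x t a → u x t a * (μ t * B t a x)) ⟩
      ∑ᵇ (λ t a → sum (λ x → u x t a * (μ t * B t a x)))
        ≈⟨ ∑ᵇ-cong (λ t a → trans (sum-cong-≋ (λ x → x∙yz≈y∙xz (u x t a) (μ t) (B t a x)))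
                                  (sym (*-distribˡ-sum (μ t) (λ x → u x t a * B t a x)))) ⟩
      ∑ᵇ (λ t a → μ t * sum (λ x → u x t a * B t a x))
        ≈⟨ ∑ᵇ-cong (λ t a → trans (*-congˡ (dual-pairing t a)) (*-identityʳ (μ t))) ⟩
      ∑ᵇ {d = d} (λ t _ → μ t)
        ≈⟨ ∑ᵇ-const {d = d} μ ⟩
      sum (λ t → fromℕ (d t) * μ t) ∎
      where
      u : Fin N → Coordinates s d
      u = unitCoordinates

module OrderedField {c ℓ₁ ℓ₂} (F : RealClosedField c ℓ₁ ℓ₂) where
  open RealClosedField F
  open RingSolver cring using (solve; _:=_; _:+_; _:*_; _:-_; :-_; ‵; ı)
  open import Algebra.Properties.Ring ring using (+-cancelˡ; x≈y⇒x∙y⁻¹≈ε; x∙y⁻¹≈ε⇒x≈y; xyx⁻¹≈y)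
  open import Relation.Binary.Structures using (IsTotalOrder)
  open IsTotalOrder isTotalOrder
    using (total; antisym)
    renaming (refl to ≤-refl; trans to ≤-trans; ≲-respˡ-≈ to ≤-respˡ-≈; ≲-respʳ-≈ to ≤-respʳ-≈)
  open import Relation.Binary.Reasoning.Setoid setoid

  square-nonneg : ∀ x → 0# ≤ (x * x)
  square-nonneg x with total 0# x
  ... | inj₁ 0≤x = *-nonneg 0≤x 0≤x
  ... | inj₂ x≤0 = ≤-respʳ-≈ (-x*-x≈x*x x) (*-nonneg 0≤-x 0≤-x)
    where
    -x*-x≈x*x : ∀ x → - x * - x ≈ x * x
    -x*-x≈x*x = solve 1 (λ x → :- x :* :- x := x :* x) refl
    0≤-x : 0# ≤ (- x)
    0≤-x = ≤-respˡ-≈ (-‿inverseʳ x) (≤-respʳ-≈ (+-identityˡ (- x)) (+-mono-≤ (- x) x≤0))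

  nonneg-+ : ∀ {x y} → 0# ≤ x → 0# ≤ y → 0# ≤ (x + y)
  nonneg-+ {x} {y} 0≤x 0≤y = ≤-trans 0≤y (≤-respˡ-≈ (+-identityˡ y) (+-mono-≤ y 0≤x))

  0≤1 : 0# ≤ 1#
  0≤1 = ≤-respʳ-≈ (*-identityˡ 1#) (square-nonneg 1#)

  fromℕ-nonneg : ∀ n → 0# ≤ fromℕ n
  fromℕ-nonneg ℕ.zero    = ≤-refl
  fromℕ-nonneg (ℕ.suc n) = nonneg-+ 0≤1 (fromℕ-nonneg n)

  fromℕ-suc-nonzero : ∀ n → ¬ fromℕ (ℕ.suc n) ≈ 0#
  fromℕ-suc-nonzero n 1+n≈0 = 1≉0 (antisym 1≤0 0≤1)
    where
    1≤0 : 1# ≤ 0#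
    1≤0 = ≤-respʳ-≈ (trans (+-comm _ 1#) 1+n≈0) (≤-respˡ-≈ (+-identityˡ 1#) (+-mono-≤ 1# (fromℕ-nonneg n)))

  fromℕ-injective : ∀ m n → fromℕ m ≈ fromℕ n → m ≡ n
  fromℕ-injective ℕ.zero    ℕ.zero    _     = ≡.refl
  fromℕ-injective ℕ.zero    (ℕ.suc n) 0≈1+n = ⊥-elim (fromℕ-suc-nonzero n (sym 0≈1+n))
  fromℕ-injective (ℕ.suc m) ℕ.zero    1+m≈0 = ⊥-elim (fromℕ-suc-nonzero m 1+m≈0)
  fromℕ-injective (ℕ.suc m) (ℕ.suc n) eq    = ≡.cong ℕ.suc (fromℕ-injective m n (+-cancelˡ 1# _ _ eq))

  *-cancelʳ-nonzero : ∀ {z x y} → ¬ z ≈ 0# → x * z ≈ y * z → x ≈ y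
  *-cancelʳ-nonzero {z} {x} {y} z≉0 xz≈yz with inverse z z≉0
  ... | z⁻¹ , zz⁻¹≈1 = begin
    x              ≈⟨ *-identityʳ x ⟨
    x * 1#         ≈⟨ *-congˡ zz⁻¹≈1 ⟨
    x * (z * z⁻¹)  ≈⟨ *-assoc x z z⁻¹ ⟨
    (x * z) * z⁻¹  ≈⟨ *-congʳ xz≈yz ⟩
    (y * z) * z⁻¹  ≈⟨ *-assoc y z z⁻¹ ⟩
    y * (z * z⁻¹)  ≈⟨ *-congˡ zz⁻¹≈1 ⟩
    y * 1#         ≈⟨ *-identityʳ y ⟩
    y              ∎

  larger-nonzero : ∀ {x y} → x ≤ y → 0# ≤ (x + y) → ¬ x + y ≈ 0# → ¬ y ≈ 0#
  larger-nonzero {x} {y} x≤y 0≤x+y x+y≉0 y≈0 = x+y≉0 (antisym x+y≤0 0≤x+y)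
    where
    x+y≤0 : (x + y) ≤ 0#
    x+y≤0 = ≤-respʳ-≈ (trans (+-cong y≈0 y≈0) (+-identityʳ 0#)) (+-mono-≤ y x≤y)

  -- Totality decides which factor is the larger one, and that one cannot vanish.
  zero-product : ∀ {x y} → 0# ≤ (x + y) → ¬ x + y ≈ 0# → x * y ≈ 0# → x ≈ 0# ⊎ y ≈ 0#
  zero-product {x} {y} 0≤x+y x+y≉0 xy≈0 with total x y
  ... | inj₁ x≤y = inj₁ (*-cancelʳ-nonzero (larger-nonzero x≤y 0≤x+y x+y≉0) (trans xy≈0 (sym (zeroˡ y))))
  ... | inj₂ y≤x = inj₂ (*-cancelʳ-nonzero (larger-nonzero y≤x 0≤y+x (x+y≉0 ∘ trans (+-comm x y)))
                                          (trans (*-comm y x) (trans xy≈0 (sym (zeroˡ x)))))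
    where
    0≤y+x : 0# ≤ (y + x)
    0≤y+x = ≤-respʳ-≈ (+-comm x y) 0≤x+y

  root-dichotomy : ∀ {X x} → 0# ≤ X → ¬ X ≈ 0# → x * (X - x) ≈ 0# → x ≈ 0# ⊎ x ≈ X
  root-dichotomy {X} {x} 0≤X X≉0 x[X-x]≈0
    with zero-product (≤-respʳ-≈ (sym x+[X-x]≈X) 0≤X) (X≉0 ∘ trans (sym x+[X-x]≈X)) x[X-x]≈0
    where
    x+[X-x]≈X : x + (X - x) ≈ X
    x+[X-x]≈X = trans (sym (+-assoc x X (- x))) (xyx⁻¹≈y x X)
  ... | inj₁ x≈0   = inj₁ x≈0
  ... | inj₂ X-x≈0 = inj₂ (sym (x∙y⁻¹≈ε⇒x≈y X x X-x≈0))

  0≤fromℕ[1+n]-1 : ∀ n → 0# ≤ (fromℕ (ℕ.suc n) - 1#)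
  0≤fromℕ[1+n]-1 n = ≤-respʳ-≈ (sym ([1+x]-1≈x (fromℕ n))) (fromℕ-nonneg n)
    where
    [1+x]-1≈x : ∀ x → (1# + x) - 1# ≈ x
    [1+x]-1≈x = solve 1 (λ x → (ı :+ x) :- ı := x) refl

  -- Eliminate k with the first relation and s + t with the first two; the second moment
  -- relation then leaves (n − 1)(s − t)².
  moment-identity : ∀ ε N̂ r k s t →
    ((ε * (N̂ - 1#)) * ((fromℕ 6 * N̂ - fromℕ 2 * ε * N̂) + ε)
      - fromℕ 6 * r * ((fromℕ 2 * N̂ - ε * N̂) + ε))
      - (fromℕ 3 * N̂ + fromℕ 9) * (r * r)
    ≈ (N̂ - 1#) * ((s - t) * (s - t))
      + ((ε * (N̂ - 1#) - (k + fromℕ 2 * r))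
           * ((fromℕ 6 * N̂ - fromℕ 4 * k - fromℕ 2 * (ε * (N̂ - 1#) - (k + fromℕ 2 * r))) + (s + t - ε - r))
        + ((k + ((N̂ + 1#) * r + (N̂ - 1#) * (s + t))) * (s + t - ε - r)
          + (k * k + ((N̂ + 1#) * (r * r) + (N̂ - 1#) * (s * s + t * t)) - fromℕ 3 * N̂ * k) * - fromℕ 2))
  moment-identity = solve 6 (λ ε N̂ r k s t →
    ((ε :* (N̂ :- ı)) :* ((‵ 6 :* N̂ :- ‵ 2 :* ε :* N̂) :+ ε)
      :- ‵ 6 :* r :* ((‵ 2 :* N̂ :- ε :* N̂) :+ ε))
      :- (‵ 3 :* N̂ :+ ‵ 9) :* (r :* r)
    := (N̂ :- ı) :* ((s :- t) :* (s :- t))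
      :+ ((ε :* (N̂ :- ı) :- (k :+ ‵ 2 :* r))
           :* ((‵ 6 :* N̂ :- ‵ 4 :* k :- ‵ 2 :* (ε :* (N̂ :- ı) :- (k :+ ‵ 2 :* r))) :+ (s :+ t :- ε :- r))
        :+ ((k :+ ((N̂ :+ ı) :* r :+ (N̂ :- ı) :* (s :+ t))) :* (s :+ t :- ε :- r)
          :+ (k :* k :+ ((N̂ :+ ı) :* (r :* r) :+ (N̂ :- ı) :* (s :* s :+ t :* t)) :- ‵ 3 :* N̂ :* k) :* :- ‵ 2)))
    refl

  x+[ap+[bq+cr]]≈x : ∀ {x a b c} p q r → a ≈ 0# → b ≈ 0# → c ≈ 0# → x + (a * p + (b * q + c * r)) ≈ x
  x+[ap+[bq+cr]]≈x {x} {a} {b} {c} p q r a≈0 b≈0 c≈0 = begin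
    x + (a * p + (b * q + c * r))     ≈⟨ +-congˡ (+-cong (*-congʳ a≈0) (+-cong (*-congʳ b≈0) (*-congʳ c≈0))) ⟩
    x + (0# * p + (0# * q + 0# * r))  ≈⟨ +-congˡ (+-cong (zeroˡ p) (+-cong (zeroˡ q) (zeroˡ r))) ⟩
    x + (0# + (0# + 0#))              ≈⟨ +-congˡ (trans (+-identityˡ _) (+-identityˡ 0#)) ⟩
    x + 0#                            ≈⟨ +-identityʳ x ⟩
    x                                 ∎

  moment-inequality : ∀ {N̂ ε k r s t} → 0# ≤ (N̂ - 1#) →
    ε * (N̂ - 1#) ≈ k + fromℕ 2 * r →
    k + ((N̂ + 1#) * r + (N̂ - 1#) * (s + t)) ≈ 0# →
    k * k + ((N̂ + 1#) * (r * r) + (N̂ - 1#) * (s * s + t * t)) ≈ fromℕ 3 * N̂ * k →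
    0# ≤ (((ε * (N̂ - 1#)) * ((fromℕ 6 * N̂ - fromℕ 2 * ε * N̂) + ε)
           - fromℕ 6 * r * ((fromℕ 2 * N̂ - ε * N̂) + ε))
           - (fromℕ 3 * N̂ + fromℕ 9) * (r * r))
  moment-inequality {N̂} {ε} {k} {r} {s} {t} 0≤N̂-1 ε-relation first-moment second-moment =
    ≤-respʳ-≈ (sym (trans (moment-identity ε N̂ r k s t)
                          (x+[ap+[bq+cr]]≈x _ _ _ (x≈y⇒x∙y⁻¹≈ε ε-relation) first-moment (x≈y⇒x∙y⁻¹≈ε second-moment))))
              (*-nonneg 0≤N̂-1 (square-nonneg (s - t)))

module SchemeSpectrum {c ℓ₁ ℓ₂} (F : RealClosedField c ℓ₁ ℓ₂)
  {N m s} {A : Fin m → Fin N → Fin N → ℕ} (scheme : IsSymAssocScheme N m A)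
  {d : Fin s → ℕ} (S : Strata F N m s A d) where

  open RealClosedField F
  open NaturalEmbedding cring
  open LinearAlgebra cring
  open OrderedField F using (*-cancelʳ-nonzero; root-dichotomy; fromℕ-nonneg)
  open IsSymAssocScheme scheme using (p₀; sum-J)
  open SchemeCombinatorics scheme
  open Strata S
  open import Relation.Binary.Reasoning.Setoid setoid

  B-spanning : ∀ v → Σ[ κ ∈ Coordinates s d ] (∀ x → v x ≈ ∑ᵇ (λ t a → κ t a * B t a x))
  B-spanning v with spanning v
  ... | κ , v≈ = κ , λ x → trans (v≈ x) (reflexive (sumR²≡∑ᵇ (λ t a → κ t a * B t a x)))

  B-independent : ∀ κ → (∀ x → ∑ᵇ (λ t a → κ t a * B t a x) ≈ 0#) → ∀ t a → κ t a ≈ 0#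
  B-independent κ κB≈0 = independent κ (λ x → trans (reflexive (sumR²≡∑ᵇ (λ t a → κ t a * B t a x))) (κB≈0 x))

  open Basis B B-spanning B-independent

  Â : Fin m → Matrix N
  Â i x y = fromℕ (A i x y)

  valency : Fin m → Carrier
  valency i = fromℕ (p₀ i i)

  -- the eigenvalue of J = I + ∑ᵢ Aᵢ on stratum t
  j : Fin s → Carrier
  j t = 1# + sum (λ i → θ i t)

  Â-eigenvector : ∀ i t a → Eigenvector (Â i) (θ i t) (B t a)
  Â-eigenvector i t a x = trans (reflexive (≡.sym (sumR≡sum (λ y → Â i x y * B t a y)))) (eigen i t a x)

  Â-row-sum : ∀ i x → sum (Â i x) ≈ valency i
  Â-row-sum i x = trans (sym (fromℕ-sumℕ (A i x))) (reflexive (≡.cong fromℕ (rowSum≡p₀ i x)))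

  J≈I+∑Â : ∀ x y → 1# ≈ fromℕ (δ x y) + sum (λ i → Â i x y)
  J≈I+∑Â x y = begin
    1#                                         ≈⟨ +-identityʳ 1# ⟨
    fromℕ 1                                    ≡⟨ ≡.cong fromℕ (sum-J x y) ⟨
    fromℕ (δ x y ℕ.+ sumℕ (λ i → A i x y))     ≈⟨ fromℕ-homo-+ (δ x y) _ ⟩
    fromℕ (δ x y) + fromℕ (sumℕ (λ i → A i x y)) ≈⟨ +-congˡ (fromℕ-sumℕ (λ i → A i x y)) ⟩
    fromℕ (δ x y) + sum (λ i → Â i x y)        ∎

  J-eigenvector : ∀ t a → Eigenvector J (j t) (B t a)
  J-eigenvector t a x = begin
    sum (λ y → 1# * B t a y)
      ≈⟨ sum-cong-≋ (λ y → trans (*-congʳ (J≈I+∑Â x y))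
                                 (trans (distribʳ (B t a y) _ _) (+-congˡ (*-distribʳ-sum (B t a y) (λ i → Â i x y))))) ⟩
    sum (λ y → fromℕ (δ x y) * B t a y + sum (λ i → Â i x y * B t a y))
      ≈⟨ ∑-distrib-+ (λ y → fromℕ (δ x y) * B t a y) (λ y → sum (λ i → Â i x y * B t a y)) ⟩
    sum (λ y → fromℕ (δ x y) * B t a y) + sum (λ y → sum (λ i → Â i x y * B t a y))
      ≈⟨ +-cong (∑-δ x (B t a)) (∑-comm (λ y i → Â i x y * B t a y)) ⟩
    B t a x + sum (λ i → sum (λ y → Â i x y * B t a y))
      ≈⟨ +-congˡ (sum-cong-≋ (λ i → Â-eigenvector i t a x)) ⟩
    B t a x + sum (λ i → θ i t * B t a x)
      ≈⟨ +-cong (*-identityˡ (B t a x)) (*-distribʳ-sum (B t a x) (λ i → θ i t)) ⟨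
    1# * B t a x + sum (λ i → θ i t) * B t a x
      ≈⟨ distribʳ (B t a x) 1# _ ⟨
    j t * B t a x ∎

  ∑-dims-θ : ∀ i → sum (λ t → fromℕ (d t) * θ i t) ≈ 0#
  ∑-dims-θ i = begin
    sum (λ t → fromℕ (d t) * θ i t)  ≈⟨ trace-eigenbasis (Â-eigenvector i) ⟨
    trace (Â i)                      ≈⟨ ∑-zero (λ x → reflexive (≡.cong fromℕ (diagonal-zero i x))) ⟩
    0#                               ∎

  ∑-dims-θ² : ∀ i → sum (λ t → fromℕ (d t) * (θ i t * θ i t)) ≈ fromℕ N * valency i
  ∑-dims-θ² i = begin
    sum (λ t → fromℕ (d t) * (θ i t * θ i t))
      ≈⟨ trace-eigenbasis (λ t a → eigenvector-· (Â-eigenvector i t a) (Â-eigenvector i t a)) ⟨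
    sum (λ x → sum (λ z → Â i x z * Â i z x))
      ≈⟨ sum-cong-≋ (λ x → trans (fromℕ-sumℕ (λ z → A i x z ℕ.* A i z x)) (sum-cong-≋ (λ z → fromℕ-homo-* (A i x z) (A i z x)))) ⟨
    sum (λ x → fromℕ (sumℕ (λ z → A i x z ℕ.* A i z x)))
      ≈⟨ sum-cong-≋ (λ x → reflexive (≡.cong fromℕ (square-diagonal≡p₀ i x))) ⟩
    sum {N} (λ _ → valency i)
      ≈⟨ ∑-const N (valency i) ⟩
    fromℕ N * valency i ∎

  ∑-dims-j : sum (λ t → fromℕ (d t) * j t) ≈ fromℕ N
  ∑-dims-j = begin
    sum (λ t → fromℕ (d t) * j t)  ≈⟨ trace-eigenbasis J-eigenvector ⟨
    trace {N} J                    ≈⟨ ∑-const N 1# ⟩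
    fromℕ N * 1#                   ≈⟨ *-identityʳ _ ⟩
    fromℕ N                        ∎

  j-dichotomy : ¬ fromℕ N ≈ 0# → ∀ t → Fin (d t) → j t ≈ 0# ⊎ j t ≈ fromℕ N
  j-dichotomy N≉0 t a =
    root-dichotomy (fromℕ-nonneg N) N≉0 (basis-vector-nonzero _ (J-eigenvalue (J-eigenvector t a)))

  θ≈valency : ∀ i {t} → Fin (d t) → ¬ j t ≈ 0# → θ i t ≈ valency i
  θ≈valency i {t} a j≉0 = *-cancelʳ-nonzero j≉0
    (scalars-unique _ _ (constant-row-sums (Â-row-sum i) (Â-eigenvector i t a) (J-eigenvector t a)))

module StrataDimensions {c ℓ} (R : CommutativeRing c ℓ) where
  open CommutativeRing R hiding (zero)
  open RingOps R using (fromℕ)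
  open LinearAlgebra R using (sum)
  open RingSolver R using (solve; _:=_; _:+_; _:*_; _:-_; ‵; ı)

  -- u and v are the two strata other than t and the (n + 1)-dimensional one.
  dims-split : ∀ q {t} → DimensionOne q t →
               ∃[ u ] ∃[ v ] ∀ (g : Fin 4 → Carrier) →
               sum (λ t′ → fromℕ (dims (2 ℕ.+ q) t′) * g t′)
                 ≈ g t + ((fromℕ (2 ℕ.+ q) + 1#) * g (suc zero) + (fromℕ (2 ℕ.+ q) - 1#) * (g u + g v))
  dims-split q stratum₀ = suc (suc zero) , suc (suc (suc zero)) , λ g →
    solve 5 (λ Q g₀ g₁ g₂ g₃ →
               ‵ 1 :* g₀ :+ ((ı :+ (ı :+ (ı :+ Q))) :* g₁ :+ ((ı :+ Q) :* g₂ :+ ((ı :+ Q) :* g₃ :+ ‵ 0)))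
            := g₀ :+ (((ı :+ (ı :+ Q)) :+ ı) :* g₁ :+ ((ı :+ (ı :+ Q)) :- ı) :* (g₂ :+ g₃)))
          refl (fromℕ q) (g zero) (g (suc zero)) (g (suc (suc zero))) (g (suc (suc (suc zero))))
  dims-split q (stratum₂ ≡.refl) = zero , suc (suc (suc zero)) , λ g →
    solve 4 (λ g₀ g₁ g₂ g₃ →
               ‵ 1 :* g₀ :+ (‵ 3 :* g₁ :+ (‵ 1 :* g₂ :+ (‵ 1 :* g₃ :+ ‵ 0)))
            := g₂ :+ ((‵ 2 :+ ı) :* g₁ :+ (‵ 2 :- ı) :* (g₀ :+ g₃)))
          refl (g zero) (g (suc zero)) (g (suc (suc zero))) (g (suc (suc (suc zero))))
  dims-split q (stratum₃ ≡.refl) = zero , suc (suc zero) , λ g →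
    solve 4 (λ g₀ g₁ g₂ g₃ →
               ‵ 1 :* g₀ :+ (‵ 3 :* g₁ :+ (‵ 1 :* g₂ :+ (‵ 1 :* g₃ :+ ‵ 0)))
            := g₃ :+ ((‵ 2 :+ ı) :* g₁ :+ (‵ 2 :- ı) :* (g₀ :+ g₂)))
          refl (g zero) (g (suc zero)) (g (suc (suc zero))) (g (suc (suc (suc zero))))

module ThreeNPointScheme {c ℓ₁ ℓ₂} (F : RealClosedField c ℓ₁ ℓ₂) (q : ℕ)
  {m} {A : Fin m → Fin (3 ℕ.* (2 ℕ.+ q)) → Fin (3 ℕ.* (2 ℕ.+ q)) → ℕ}
  (scheme : IsSymAssocScheme (3 ℕ.* (2 ℕ.+ q)) m A)
  (S : Strata F (3 ℕ.* (2 ℕ.+ q)) m 4 A (dims (2 ℕ.+ q))) where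

  open RealClosedField F
  open NaturalEmbedding cring
  open LinearAlgebra cring using (sum; sum-cong-≋; *-distribʳ-sum; fromℕ-sumℕ)
  open OrderedField F using (fromℕ-suc-nonzero; fromℕ-injective; *-cancelʳ-nonzero)
  open StrataDimensions cring
  open SchemeSpectrum F scheme S
  open Strata S using (θ)
  open import Relation.Binary.Reasoning.Setoid setoid

  n : ℕ
  n = 2 ℕ.+ q

  N̂ X : Carrier
  N̂ = fromℕ n
  X = fromℕ (3 ℕ.* n)

  X≉0 : ¬ X ≈ 0#
  X≉0 = fromℕ-suc-nonzero (ℕ.suc (q ℕ.+ 2 ℕ.* n))

  some-basis-vector : ∀ t → Fin (dims n t)
  some-basis-vector zero                   = zero
  some-basis-vector (suc zero)             = zero
  some-basis-vector (suc (suc zero))       = zero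
  some-basis-vector (suc (suc (suc zero))) = zero

  dichotomy : ∀ t → j t ≈ 0# ⊎ j t ≈ X
  dichotomy t = j-dichotomy X≉0 t (some-basis-vector t)

  -- Counting the strata with j = 3n by dimension, tr J = 3n says these dimensions add up to 1.
  ones-stratum : ∃[ t ] (DimensionOne q t × j t ≈ X)
  ones-stratum = locate-dimension-one q dichotomy (fromℕ-injective _ 1 (*-cancelʳ-nonzero X≉0 weighted-count))
    where
    counted : ∀ {t} (o : j t ≈ 0# ⊎ j t ≈ X) → fromℕ (χ o ℕ.* dims n t) * X ≈ fromℕ (dims n t) * j t
    counted     (inj₁ j≈0) = trans (zeroˡ X) (sym (trans (*-congˡ j≈0) (zeroʳ _)))
    counted {t} (inj₂ j≈X) = *-cong (reflexive (≡.cong fromℕ (ℕ.+-identityʳ (dims n t)))) (sym j≈X)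

    weighted-count : fromℕ (sumℕ (λ t → χ (dichotomy t) ℕ.* dims n t)) * X ≈ fromℕ 1 * X
    weighted-count = begin
      fromℕ (sumℕ (λ t → χ (dichotomy t) ℕ.* dims n t)) * X  ≈⟨ *-congʳ (fromℕ-sumℕ (λ t → χ (dichotomy t) ℕ.* dims n t)) ⟩
      sum (λ t → fromℕ (χ (dichotomy t) ℕ.* dims n t)) * X   ≈⟨ *-distribʳ-sum X (λ t → fromℕ (χ (dichotomy t) ℕ.* dims n t)) ⟩
      sum (λ t → fromℕ (χ (dichotomy t) ℕ.* dims n t) * X)   ≈⟨ sum-cong-≋ (λ t → counted (dichotomy t)) ⟩
      sum (λ t → fromℕ (dims n t) * j t)                     ≈⟨ ∑-dims-j ⟩
      X                                                      ≈⟨ trans (*-congʳ (+-identityʳ 1#)) (*-identityˡ X) ⟨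
      fromℕ 1 * X                                            ∎

  moments : ∀ i → let r = θ i (suc zero) ; k = valency i in
            ∃[ s ] ∃[ t ] ( k + ((N̂ + 1#) * r + (N̂ - 1#) * (s + t)) ≈ 0#
                          × k * k + ((N̂ + 1#) * (r * r) + (N̂ - 1#) * (s * s + t * t)) ≈ fromℕ 3 * N̂ * k)
  moments i =
    let t₁ , dimension-one , j≈X = ones-stratum
        u , v , split = dims-split q dimension-one
        θ≈k : θ i t₁ ≈ valency i
        θ≈k = θ≈valency i (some-basis-vector t₁) (X≉0 ∘ trans (sym j≈X))
    in θ i u , θ i v ,
       trans (+-congʳ (sym θ≈k)) (trans (sym (split (θ i))) (∑-dims-θ i)) ,
       trans (+-congʳ (sym (*-cong θ≈k θ≈k)))
             (trans (sym (split (λ t → θ i t * θ i t))) (trans (∑-dims-θ² i) (*-congʳ (fromℕ-homo-* 3 n))))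

lemma4p6 : ∀ {c ℓ₁ ℓ₂} (F : RealClosedField c ℓ₁ ℓ₂) (n : ℕ) → 2 Data.Nat.≤ n →
  (m : ℕ) (A : Fin m → Fin (3 Data.Nat.* n) → Fin (3 Data.Nat.* n) → ℕ) →
  IsSymAssocScheme (3 Data.Nat.* n) m A →
  (S : Strata F (3 Data.Nat.* n) m 4 A (dims n)) →
  ∀ (i : Fin m) (x : Fin (3 Data.Nat.* n)) →
  let open RealClosedField F
      N̂ = fromℕ n
      k = fromℕ (rowSum A i x)
      r = Strata.θ S i (suc zero)
  in ∀ (ε : Carrier) → ε * (N̂ - 1#) ≈ k + fromℕ 2 * r →
     0# ≤ (((ε * (N̂ - 1#)) * ((fromℕ 6 * N̂ - fromℕ 2 * ε * N̂) + ε)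
            - fromℕ 6 * r * ((fromℕ 2 * N̂ - ε * N̂) + ε))
            - (fromℕ 3 * N̂ + fromℕ 9) * (r * r))
lemma4p6 F (ℕ.suc (ℕ.suc q)) (ℕ.s≤s (ℕ.s≤s ℕ.z≤n)) m A scheme S i x ε ε-relation =
  let s , t , first-moment , second-moment = ThreeNPointScheme.moments F q scheme S i
  in moment-inequality (0≤fromℕ[1+n]-1 (ℕ.suc q))
                       (trans ε-relation (+-congʳ (reflexive (≡.cong fromℕ (rowSum≡p₀ i x)))))
                       first-moment second-moment
  where
  open RealClosedField F
  open OrderedField F using (moment-inequality; 0≤fromℕ[1+n]-1)
  open SchemeCombinatorics scheme using (rowSum≡p₀)
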